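{- $\pi_{\mathrm{loc}}(P_4,3)\leq \frac{3}{8}$, where $P_4$ is a perfect path with $4$ vertices in $Q_3$.
   Context: $Q_n$ is the $n$-dimensional hypercube graph on binary $n$-tuples (adjacent iff differing in one coordinate). A sub-$d$-cube of $Q_n$ is obtained by fixing $n-d$ coordinates and letting the other $d$ vary, and is identified with $Q_d$. A configuration in $Q_d$ is a subset of $V(Q_d)$; $K$ is an exact copy of $H$ if some automorphism of $Q_d$ maps $H$ onto $K$. A perfect path $P_{d+1}$ in $Q_d$ is the vertex set of a path in $Q_d$ with $d+1$ vertices whose endpoints are at Hamming distance $d$. For $S\subseteq V(Q_n)$ and a vertex $v$, let $G_v(H,d,n,S)$ be the number of sub-$d$-cubes $R$ of $Q_n$ containing $v$ such that $S\cap R$ is an exact copy of $H$. Let $\mathrm{ex}^{\mathrm{in}}_{\mathrm{loc}}(H,d,n)$ be the maximum of $G_v(H,d,n,S)/\binom{n}{d}$ over all $S\subseteq V(Q_n)$ and $v\in S$, and $\mathrm{ex}^{\mathrm{out}}_{\mathrm{loc}}(H,d,n)$ the same maximum over all $S$ and $v\notin S$; both are nonincreasing in $n$, and $\pi^{\mathrm{in}}_{\mathrm{loc}}(H,d)$, $\pi^{\mathrm{out}}_{\mathrm{loc}}(H,d)$ denote their limits as $n\to\infty$. Finally $\pi_{\mathrm{loc}}(H,d)=\max\{\pi^{\mathrm{in}}_{\mathrm{loc}}(H,d),\pi^{\mathrm{out}}_{\mathrm{loc}}(H,d)\}$. -}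

module Defs where

open import Data.Bool using (Bool; true; false; _xor_)
open import Data.Nat using (ℕ; zero; suc; _+_; _*_; _≤_)
open import Data.Nat.Combinatorics using (_C_)
open import Data.Fin using (Fin; fromℕ; inject₁)
open import Data.Vec using (Vec; []; _∷_; lookup)
open import Data.List using (List; length)
open import Data.List.Relation.Unary.All using (All)
open import Data.List.Relation.Unary.Unique.Propositional using (Unique)
open import Data.Product using (Σ; _×_; ∃; ∃-syntax)
open import Relation.Binary.PropositionalEquality using (_≡_)

Vertex : ℕ → Set
Vertex d = Vec Bool d

Config : ℕ → Set
Config d = Vertex d → Bool

dist : ∀ {d} → Vertex d → Vertex d → ℕ
dist [] [] = 0
dist (a ∷ x) (b ∷ y) with a xor b
... | true  = suc (dist x y)
... | false = dist x y

Adjacent : ∀ {d} → Vertex d → Vertex d → Set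
Adjacent x y = dist x y ≡ 1

IsAutomorphism : ∀ {d} → (Vertex d → Vertex d) → Set
IsAutomorphism {d} σ =
  (Σ (Vertex d → Vertex d) λ τ → (∀ x → τ (σ x) ≡ x) × (∀ y → σ (τ y) ≡ y))
  × (∀ x y → (Adjacent x y → Adjacent (σ x) (σ y)) × (Adjacent (σ x) (σ y) → Adjacent x y))

ExactCopy : ∀ {d} → Config d → Config d → Set
ExactCopy {d} H K =
  Σ (Vertex d → Vertex d) λ σ → IsAutomorphism σ ×
    (∀ y → (K y ≡ true → ∃[ x ] (H x ≡ true × σ x ≡ y))
         × (∃[ x ] (H x ≡ true × σ x ≡ y) → K y ≡ true))

IsPerfectPath : ∀ d → Config d → Set
IsPerfectPath d H =
  Σ (Vec (Vertex d) (suc d)) λ p →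
    (∀ (i : Fin d) → Adjacent (lookup p (inject₁ i)) (lookup p (Fin.suc i)))
    × dist (lookup p Fin.zero) (lookup p (fromℕ d)) ≡ d
    × (∀ x → (H x ≡ true → ∃[ i ] (lookup p i ≡ x))
           × (∃[ i ] (lookup p i ≡ x) → H x ≡ true))

-- A choice of d free coordinates among n (equivalently a d-subset of the
-- n coordinates). Together with a vertex v, it determines the sub-d-cube
-- containing v whose free coordinates are the chosen ones (the others fixed
-- to v's values); every sub-d-cube containing v arises from exactly one choice.
data Choice : ℕ → ℕ → Set where
  []    : Choice 0 0
  free  : ∀ {n d} → Choice n d → Choice (suc n) (suc d)
  fixed : ∀ {n d} → Choice n d → Choice (suc n) d

-- The identification of Q_d with the sub-d-cube (free coordinates in
-- increasing order).
embed : ∀ {n d} → Choice n d → Vertex n → Vertex d → Vertex n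
embed []        []      []      = []
embed (free c)  (a ∷ v) (b ∷ x) = b ∷ embed c v x
embed (fixed c) (a ∷ v) x       = a ∷ embed c v x

trace : ∀ {n d} → Config n → Vertex n → Choice n d → Config d
trace S v c x = S (embed c v x)

-- "G_v(H,d,n,S) * m ≤ B" : every duplicate-free list of sub-d-cubes containing v
-- on which S is an exact copy of H has length at most B.
GBoundedBy : ∀ {d} → (H : Config d) (n : ℕ) → Config n → Vertex n → ℕ → ℕ → Set
GBoundedBy {d} H n S v m B =
  ∀ (cs : List (Choice n d)) → Unique cs → All (λ c → ExactCopy H (trace S v c)) cs
    → length cs * m ≤ B

module Submission where

-- Normalise S at v: `agrees S v u` records whether v ⊕ u and v have the same membership in S.
-- Call directions (x, y, z) a good triple when v ⊕ eₓ differs in this respect from v ⊕ e_y and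
-- from v ⊕ e_z, while the corner v ⊕ eₓ ⊕ e_y agrees with v and the corner v ⊕ eₓ ⊕ e_z does not.
-- An exhaustive check over Q₃ shows that every sub-3-cube through v carrying a copy of P₄ contains a
-- good triple of its own directions; as the triple determines the sub-cube, G_v is at most the number
-- of good triples of Qₙ. For a fixed x the admissible y and z together are the directions whose side
-- differs from that of x, of which there are m or m′ (where m + m′ = n), so AM-GM bounds the number of
-- good triples by (m m′² + m′ m²)/4 ≤ n³/16 = (3/8 + o(1)) C(n,3).

open import Defs
open import Data.Nat using (ℕ; suc; _+_; _*_; _≤_)
open import Data.Nat.Combinatorics using (_C_)
open import Data.Product using (∃-syntax)

open import Function using (_∘_; case_of_; _⇔_; mk⇔; Equivalence)
open import Function.Properties.Equivalence using () renaming (trans to ⇔-trans; sym to ⇔-sym)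
open import Data.Bool using (Bool; true; false; not; _∧_; _xor_; T)
open import Data.Bool.Properties using (xor-same; xor-identityʳ; T-≡; T-∧; ⇔→≡)
  renaming (_≟_ to _≟ᵇ_)
open import Data.Nat using (zero; z≤n; s≤s; _≟_)
open import Data.Nat.Properties
  using (+-suc; +-assoc; +-comm; *-assoc; *-comm; *-zeroʳ; *-distribˡ-+; ≤-total; m≤m+n;
         m≤n⇒∃[o]m+o≡n; +-mono-≤; *-monoʳ-≤; *-monoˡ-≤; *-cancelˡ-≤; module ≤-Reasoning)
open import Data.Nat.Combinatorics using (nCk+nC[k+1]≡[n+1]C[k+1]; nC1≡n)
open import Data.Nat.Tactic.RingSolver using (solve-∀)
open import Data.Fin using (Fin; inject₁) renaming (zero to fzero; suc to fsuc)
import Data.Fin.Properties as Finₚ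
open import Data.Vec using (Vec; []; _∷_; zipWith; replicate; _[_]≔_; lookup)
  renaming (map to mapᵥ)
open import Data.Vec.Properties using (≡-dec; lookup-map)
open import Data.Vec.Membership.Propositional using () renaming (_∈_ to _∈ᵥ_)
open import Data.Vec.Membership.Propositional.Properties using (∈-lookup)
  renaming (∈-map⁺ to ∈ᵥ-map⁺)
import Data.Vec.Membership.DecPropositional as VecDecMembership
import Data.Vec.Relation.Unary.Any as VecAny
open import Data.Vec.Relation.Unary.Any.Properties using (lookup-index)
open import Data.List using (List; []; _∷_; _++_; length; map; concatMap; filterᵇ; allFin;
  cartesianProduct; cartesianProductWith)
open import Data.Nat.ListAction using (sum)
open import Data.List.Properties using (length-++; length-map; length-tabulate; map-cong)
open import Data.List.Membership.Propositional using (_∈_; lose)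
open import Data.List.Membership.Propositional.Properties
  using (∈-allFin; ∈-cartesianProductWith⁺; ∈-cartesianProduct⁺; ∈-concatMap⁺; ∈-filter⁺;
         ∈-map⁺; ∈-map⁻; ∈-∃++; ∈-++⁻; ∈-++⁺ˡ; ∈-++⁺ʳ)
open import Data.List.Relation.Binary.Subset.Propositional using (_⊆_)
open import Data.List.Relation.Unary.All as All using (All; []; _∷_)
open import Data.List.Relation.Unary.Any using (here; there; satisfied)
import Data.List.Relation.Unary.Any as Any
open import Data.List.Relation.Unary.Unique.Propositional using (Unique; _∷_)
import Data.List.Relation.Unary.Unique.Propositional.Properties as Unique
open import Data.Product using (_×_; _,_; proj₁; proj₂)
open import Data.Sum using (_⊎_; inj₁; inj₂)
open import Data.Empty using (⊥-elim)
open import Relation.Nullary using (¬_; Dec; yes; no; does; ¬?; _×-dec_; _⊎-dec_; _→-dec_)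
open import Relation.Nullary.Decidable using (toWitness; map′; does-⇔; T?)
open import Relation.Unary using (Decidable)
open import Relation.Binary.PropositionalEquality
  using (_≡_; _≢_; refl; sym; trans; cong; cong₂; subst; subst₂; _≗_; module ≡-Reasoning)

Unique∧⊆⇒length≤ : ∀ {A : Set} {xs ys : List A} → Unique xs → xs ⊆ ys → length xs ≤ length ys
Unique∧⊆⇒length≤ {xs = []}     _              _     = z≤n
Unique∧⊆⇒length≤ {xs = x ∷ xs} (x∉xs ∷ unique) xs⊆ys
  with us , vs , refl ← ∈-∃++ (xs⊆ys (here refl)) =
  subst (suc (length xs) ≤_) (sym length-us++x∷vs) (s≤s (Unique∧⊆⇒length≤ unique xs⊆us++vs))
  where
    xs⊆us++vs : xs ⊆ us ++ vs
    xs⊆us++vs {y} y∈xs with ∈-++⁻ us (xs⊆ys (there y∈xs))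
    ... | inj₁ y∈us         = ∈-++⁺ˡ y∈us
    ... | inj₂ (there y∈vs) = ∈-++⁺ʳ us y∈vs
    ... | inj₂ (here refl)  = ⊥-elim (All.lookup x∉xs y∈xs refl)

    length-us++x∷vs : length (us ++ x ∷ vs) ≡ suc (length (us ++ vs))
    length-us++x∷vs = begin
      length (us ++ x ∷ vs)        ≡⟨ length-++ us ⟩
      length us + suc (length vs)  ≡⟨ +-suc (length us) (length vs) ⟩
      suc (length us + length vs)  ≡⟨ cong suc (length-++ us) ⟨
      suc (length (us ++ vs))      ∎
      where open ≡-Reasoning

count : ∀ {A : Set} → (A → Bool) → List A → ℕ
count p xs = length (filterᵇ p xs)

count-∧-split : ∀ {A : Set} (p q : A → Bool) xs →
  count (λ a → p a ∧ q a) xs + count (λ a → p a ∧ not (q a)) xs ≡ count p xs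
count-∧-split p q []       = refl
count-∧-split p q (x ∷ xs) with p x | q x
... | true  | true  = cong suc (count-∧-split p q xs)
... | true  | false = trans (+-suc _ _) (cong suc (count-∧-split p q xs))
... | false | _     = count-∧-split p q xs

count-complement : ∀ {A : Set} (p : A → Bool) xs → count p xs + count (not ∘ p) xs ≡ length xs
count-complement p []       = refl
count-complement p (x ∷ xs) with p x
... | true  = cong suc (count-complement p xs)
... | false = trans (+-suc _ _) (cong suc (count-complement p xs))

sum-map-∘-Bool : ∀ {A : Set} (f : Bool → ℕ) (b : A → Bool) xs →
  sum (map (f ∘ b) xs) ≡ count b xs * f true + count (not ∘ b) xs * f false
sum-map-∘-Bool f b []       = refl
sum-map-∘-Bool f b (x ∷ xs) with b x
... | true  = trans (cong (f true +_) (sum-map-∘-Bool f b xs)) (sym (+-assoc (f true) _ _))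
... | false = trans (cong (f false +_) (sum-map-∘-Bool f b xs))
                    (x+[y+z]≡y+[x+z] (f false) (count b xs * f true) _)
  where
    x+[y+z]≡y+[x+z] : ∀ x y z → x + (y + z) ≡ y + (x + z)
    x+[y+z]≡y+[x+z] = solve-∀

sum-map-mono-≤ : ∀ {A : Set} {f h : A → ℕ} → (∀ a → f a ≤ h a) → ∀ xs → sum (map f xs) ≤ sum (map h xs)
sum-map-mono-≤ f≤h []       = z≤n
sum-map-mono-≤ f≤h (x ∷ xs) = +-mono-≤ (f≤h x) (sum-map-mono-≤ f≤h xs)

*-distribˡ-sum-map : ∀ {A : Set} m (f : A → ℕ) xs → m * sum (map f xs) ≡ sum (map (λ a → m * f a) xs)
*-distribˡ-sum-map m f []       = *-zeroʳ m
*-distribˡ-sum-map m f (x ∷ xs) =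
  trans (*-distribˡ-+ m (f x) _) (cong (m * f x +_) (*-distribˡ-sum-map m f xs))

length-concatMap : ∀ {A B : Set} (f : A → List B) xs →
  length (concatMap f xs) ≡ sum (map (length ∘ f) xs)
length-concatMap f []       = refl
length-concatMap f (x ∷ xs) = trans (length-++ (f x)) (cong (length (f x) +_) (length-concatMap f xs))

length-cartesianProduct : ∀ {A B : Set} (xs : List A) (ys : List B) →
  length (cartesianProduct xs ys) ≡ length xs * length ys
length-cartesianProduct []       ys = refl
length-cartesianProduct (x ∷ xs) ys = begin
  length (map (x ,_) ys ++ cartesianProduct xs ys)
    ≡⟨ length-++ (map (x ,_) ys) ⟩
  length (map (x ,_) ys) + length (cartesianProduct xs ys)
    ≡⟨ cong₂ _+_ (length-map (x ,_) ys) (length-cartesianProduct xs ys) ⟩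
  length ys + length xs * length ys
    ∎
  where open ≡-Reasoning

am-gm-≤ : ∀ {a b} → a ≤ b → 4 * (a * b) ≤ (a + b) * (a + b)
am-gm-≤ {a} a≤b with d , refl ← m≤n⇒∃[o]m+o≡n a≤b =
  subst (4 * (a * (a + d)) ≤_) (square-of-sum a d) (m≤m+n _ (d * d))
  where
    square-of-sum : ∀ a d → 4 * (a * (a + d)) + d * d ≡ (a + (a + d)) * (a + (a + d))
    square-of-sum = solve-∀

am-gm : ∀ a b → 4 * (a * b) ≤ (a + b) * (a + b)
am-gm a b with ≤-total a b
... | inj₁ a≤b = am-gm-≤ a≤b
... | inj₂ b≤a = subst₂ _≤_ (cong (4 *_) (*-comm b a)) (cong (λ s → s * s) (+-comm b a)) (am-gm-≤ b≤a)

cube-bound : ∀ a b → 4 * (a * (b * b) + b * (a * a)) ≤ (a + b) * ((a + b) * (a + b))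
cube-bound a b = begin
  4 * (a * (b * b) + b * (a * a))  ≡⟨ factor a b ⟩
  4 * (a * b) * (a + b)            ≤⟨ *-monoˡ-≤ (a + b) (am-gm a b) ⟩
  (a + b) * (a + b) * (a + b)      ≡⟨ *-comm ((a + b) * (a + b)) (a + b) ⟩
  (a + b) * ((a + b) * (a + b))    ∎
  where
    open ≤-Reasoning
    factor : ∀ a b → 4 * (a * (b * b) + b * (a * a)) ≡ 4 * (a * b) * (a + b)
    factor = solve-∀

2*C[1+m,2] : ∀ m → 2 * (suc m C 2) ≡ suc m * m
2*C[1+m,2] zero    = refl
2*C[1+m,2] (suc m) = begin
  2 * (suc (suc m) C 2)              ≡⟨ cong (2 *_) (nCk+nC[k+1]≡[n+1]C[k+1] (suc m) 1) ⟨
  2 * (suc m C 1 + suc m C 2)        ≡⟨ cong (λ c → 2 * (c + suc m C 2)) (nC1≡n (suc m)) ⟩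
  2 * (suc m + suc m C 2)            ≡⟨ *-distribˡ-+ 2 (suc m) (suc m C 2) ⟩
  2 * suc m + 2 * (suc m C 2)        ≡⟨ cong (2 * suc m +_) (2*C[1+m,2] m) ⟩
  2 * suc m + suc m * m              ≡⟨ collect m ⟩
  suc (suc m) * suc m                ∎
  where
    open ≡-Reasoning
    collect : ∀ m → 2 * suc m + suc m * m ≡ suc (suc m) * suc m
    collect = solve-∀

6*C[2+m,3] : ∀ m → 6 * (suc (suc m) C 3) ≡ suc (suc m) * (suc m * m)
6*C[2+m,3] zero    = refl
6*C[2+m,3] (suc m) = begin
  6 * (suc (suc (suc m)) C 3)
    ≡⟨ cong (6 *_) (nCk+nC[k+1]≡[n+1]C[k+1] (suc (suc m)) 2) ⟨
  6 * (suc (suc m) C 2 + suc (suc m) C 3)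
    ≡⟨ *-distribˡ-+ 6 (suc (suc m) C 2) (suc (suc m) C 3) ⟩
  6 * (suc (suc m) C 2) + 6 * (suc (suc m) C 3)
    ≡⟨ cong (_+ 6 * (suc (suc m) C 3)) (*-assoc 3 2 (suc (suc m) C 2)) ⟩
  3 * (2 * (suc (suc m) C 2)) + 6 * (suc (suc m) C 3)
    ≡⟨ cong₂ (λ a b → 3 * a + b) (2*C[1+m,2] (suc m)) (6*C[2+m,3] m) ⟩
  3 * (suc (suc m) * suc m) + suc (suc m) * (suc m * m)
    ≡⟨ collect m ⟩
  suc (suc (suc m)) * (suc (suc m) * suc m)
    ∎
  where
    open ≡-Reasoning
    collect : ∀ m → 3 * (suc (suc m) * suc m) + suc (suc m) * (suc m * m)
                  ≡ suc (suc (suc m)) * (suc (suc m) * suc m)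
    collect = solve-∀

cube⇒binomial-bound : ∀ K L n → 2 + 2 * K ≤ n → 16 * L ≤ n * (n * n) →
  L * (8 * K) ≤ (3 * K + 8) * (n C 3)
cube⇒binomial-bound K L _ n₀≤n 16L≤n³ with s , refl ← m≤n⇒∃[o]m+o≡n n₀≤n = *-cancelˡ-≤ 6 (begin
  6 * (L * (8 * K))                  ≡⟨ regroup K L ⟩
  3 * K * (16 * L)                   ≤⟨ *-monoʳ-≤ (3 * K) 16L≤n³ ⟩
  3 * K * (n * (n * n))              ≤⟨ m≤m+n _ (n * slack) ⟩
  3 * K * (n * (n * n)) + n * slack  ≡⟨ expand K s ⟩
  (3 * K + 8) * (n * (suc m * m))    ≡⟨ cong ((3 * K + 8) *_) (6*C[2+m,3] m) ⟨
  (3 * K + 8) * (6 * (n C 3))        ≡⟨ swap (3 * K + 8) (n C 3) ⟩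
  6 * ((3 * K + 8) * (n C 3))        ∎)
  where
    open ≤-Reasoning
    m = 2 * K + s
    n = 2 + m
    -- ((3K + 8) n (n - 1) (n - 2) - 3K n³) / n, which has nonnegative coefficients in K and s
    slack = 14 * K * K + 23 * K * s + 8 * s * s + 4 * K + 8 * s
    regroup : ∀ K L → 6 * (L * (8 * K)) ≡ 3 * K * (16 * L)
    regroup = solve-∀
    expand : ∀ K s → 3 * K * ((2 + 2 * K + s) * ((2 + 2 * K + s) * (2 + 2 * K + s)))
                       + (2 + 2 * K + s) * (14 * K * K + 23 * K * s + 8 * s * s + 4 * K + 8 * s)
                     ≡ (3 * K + 8) * ((2 + 2 * K + s) * (suc (2 * K + s) * (2 * K + s)))
    expand = solve-∀
    swap : ∀ a b → a * (6 * b) ≡ 6 * (a * b)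
    swap = solve-∀

infixl 6 _⊕_

_⊕_ : ∀ {d} → Vertex d → Vertex d → Vertex d
_⊕_ = zipWith _xor_

zeros : ∀ {d} → Vertex d
zeros = replicate _ false

unit : ∀ {d} → Fin d → Vertex d
unit i = zeros [ i ]≔ true

restrict : ∀ {n d} → Choice n d → Vertex n → Vertex d
restrict []        []      = []
restrict (free c)  (a ∷ v) = a ∷ restrict c v
restrict (fixed c) (a ∷ v) = restrict c v

pos : ∀ {n d} → Choice n d → Fin d → Fin n
pos (free c)  fzero    = fzero
pos (free c)  (fsuc j) = fsuc (pos c j)
pos (fixed c) j        = fsuc (pos c j)

isFree : ∀ {n d} → Choice n d → Fin n → Bool
isFree (free c)  fzero    = true
isFree (fixed c) fzero    = false
isFree (free c)  (fsuc i) = isFree c i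
isFree (fixed c) (fsuc i) = isFree c i

embed-restrict : ∀ {n d} (c : Choice n d) v → embed c v (restrict c v) ≡ v
embed-restrict []        []      = refl
embed-restrict (free c)  (a ∷ v) = cong (a ∷_) (embed-restrict c v)
embed-restrict (fixed c) (a ∷ v) = cong (a ∷_) (embed-restrict c v)

embed-translate : ∀ {n d} (c : Choice n d) v u → embed c v (restrict c v ⊕ u) ≡ v ⊕ embed c zeros u
embed-translate []        []      []      = refl
embed-translate (free c)  (a ∷ v) (b ∷ u) = cong ((a xor b) ∷_) (embed-translate c v u)
embed-translate (fixed c) (a ∷ v) u       =
  cong₂ _∷_ (sym (xor-identityʳ a)) (embed-translate c v u)

embed-zeros : ∀ {n d} (c : Choice n d) → embed c zeros zeros ≡ zeros
embed-zeros []        = refl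
embed-zeros (free c)  = cong (false ∷_) (embed-zeros c)
embed-zeros (fixed c) = cong (false ∷_) (embed-zeros c)

embed-zeros-⊕ : ∀ {n d} (c : Choice n d) x y → embed c zeros (x ⊕ y) ≡ embed c zeros x ⊕ embed c zeros y
embed-zeros-⊕ []        []      []      = refl
embed-zeros-⊕ (free c)  (a ∷ x) (b ∷ y) = cong ((a xor b) ∷_) (embed-zeros-⊕ c x y)
embed-zeros-⊕ (fixed c) x       y       = cong (false ∷_) (embed-zeros-⊕ c x y)

embed-unit : ∀ {n d} (c : Choice n d) j → embed c zeros (unit j) ≡ unit (pos c j)
embed-unit (free c)  fzero    = cong (true ∷_) (embed-zeros c)
embed-unit (free c)  (fsuc j) = cong (false ∷_) (embed-unit c j)
embed-unit (fixed c) j        = cong (false ∷_) (embed-unit c j)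

isFree-pos : ∀ {n d} (c : Choice n d) j → isFree c (pos c j) ≡ true
isFree-pos (free c)  fzero    = refl
isFree-pos (free c)  (fsuc j) = isFree-pos c j
isFree-pos (fixed c) j        = isFree-pos c j

isFree⇒pos : ∀ {n d} (c : Choice n d) i → isFree c i ≡ true → ∃[ j ] pos c j ≡ i
isFree⇒pos (free c)  fzero    _  = fzero , refl
isFree⇒pos (free c)  (fsuc i) eq with j , refl ← isFree⇒pos c i eq = fsuc j , refl
isFree⇒pos (fixed c) (fsuc i) eq with j , refl ← isFree⇒pos c i eq = j , refl

isFree-injective : ∀ {n d} (c c′ : Choice n d) → isFree c ≗ isFree c′ → c ≡ c′
isFree-injective []        []         _  = refl
isFree-injective (free c)  (free c′)  eq = cong free (isFree-injective c c′ (eq ∘ fsuc))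
isFree-injective (fixed c) (fixed c′) eq = cong fixed (isFree-injective c c′ (eq ∘ fsuc))
isFree-injective (free c)  (fixed c′) eq with () ← eq fzero
isFree-injective (fixed c) (free c′)  eq with () ← eq fzero

agrees : ∀ {d} → Config d → Vertex d → Vertex d → Bool
agrees S v u = not (S (v ⊕ u) xor S v)

agrees-cong : ∀ {d} {S S′ : Config d} → S ≗ S′ → ∀ v → agrees S v ≗ agrees S′ v
agrees-cong eq v u rewrite eq (v ⊕ u) | eq v = refl

agrees-trace : ∀ {n d} (S : Config n) v (c : Choice n d) →
  agrees (trace S v c) (restrict c v) ≗ agrees S v ∘ embed c zeros
agrees-trace S v c u rewrite embed-translate c v u | embed-restrict c v = refl

module _ {d} (g : Vertex d → Bool) where

  side : Fin d → Bool
  side i = g (unit i)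

  differ cornerAgrees agreeingPair disagreeingPair : Fin d → Fin d → Bool
  differ x y          = side x xor side y
  cornerAgrees x y    = g (unit x ⊕ unit y)
  agreeingPair x y    = differ x y ∧ cornerAgrees x y
  disagreeingPair x z = differ x z ∧ not (cornerAgrees x z)

  goodTriple : Fin d × Fin d × Fin d → Bool
  goodTriple (x , y , z) = agreeingPair x y ∧ disagreeingPair x z

HasGoodTriple : ∀ {d} → (Vertex d → Bool) → Set
HasGoodTriple g = ∃[ t ] T (goodTriple g t)

goodTriple-cong : ∀ {d} {g h : Vertex d → Bool} → g ≗ h → goodTriple g ≗ goodTriple h
goodTriple-cong eq (x , y , z)
  rewrite eq (unit x) | eq (unit y) | eq (unit z) | eq (unit x ⊕ unit y) | eq (unit x ⊕ unit z) = refl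

map₃ : ∀ {A B : Set} → (A → B) → A × A × A → B × B × B
map₃ f (x , y , z) = f x , f y , f z

goodTriple-embed : ∀ {n d} (c : Choice n d) (g : Vertex n → Bool) t →
  goodTriple (g ∘ embed c zeros) t ≡ goodTriple g (map₃ (pos c) t)
goodTriple-embed c g (x , y , z)
  rewrite embed-zeros-⊕ c (unit x) (unit y) | embed-zeros-⊕ c (unit x) (unit z)
        | embed-unit c x | embed-unit c y | embed-unit c z = refl

goodTriple-trace : ∀ {n d} (S : Config n) v (c : Choice n d) t →
  goodTriple (agrees (trace S v c) (restrict c v)) t ≡ goodTriple (agrees S v) (map₃ (pos c) t)
goodTriple-trace S v c t =
  trans (goodTriple-cong (agrees-trace S v c) t) (goodTriple-embed c (agrees S v) t)

-- Copies of P₄ in Q₃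

vertices : ∀ d → List (Vertex d)
vertices zero    = [] ∷ []
vertices (suc d) = cartesianProductWith _∷_ (false ∷ true ∷ []) (vertices d)

∈-vertices : ∀ {d} (x : Vertex d) → x ∈ vertices d
∈-vertices []      = here refl
∈-vertices (b ∷ x) = ∈-cartesianProductWith⁺ _∷_ {xs = false ∷ true ∷ []} (∈-bits b) (∈-vertices x)
  where
    ∈-bits : ∀ b → b ∈ false ∷ true ∷ []
    ∈-bits false = here refl
    ∈-bits true  = there (here refl)

∀-vertex? : ∀ {d} {P : Vertex d → Set} → Decidable P → Dec (∀ x → P x)
∀-vertex? P? = map′ (λ all x → All.lookup all (∈-vertices x))
                    (λ all → All.tabulate (λ {x} _ → all x))
                    (All.all? P? (vertices _))

triples : ∀ {A : Set} → List A → List (A × A × A)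
triples xs = cartesianProduct xs (cartesianProduct xs xs)

∈-triples : ∀ {d} (t : Fin d × Fin d × Fin d) → t ∈ triples (allFin d)
∈-triples (x , y , z) =
  ∈-cartesianProduct⁺ (∈-allFin x) (∈-cartesianProduct⁺ (∈-allFin y) (∈-allFin z))

hasGoodTriple? : ∀ {d} (g : Vertex d → Bool) → Dec (HasGoodTriple g)
hasGoodTriple? {d} g = map′ satisfied (λ (t , good) → lose (∈-triples t) good)
                            (Any.any? (T? ∘ goodTriple g) (triples (allFin d)))

vertexSet : ∀ {d k} → Vec (Vertex d) k → Config d
vertexSet qs y = does (y ∈? qs)
  where open VecDecMembership (≡-dec _≟ᵇ_)

InducedPath₄ : ∀ {d} → Vertex d → Vertex d → Vertex d → Vertex d → Set
InducedPath₄ q₀ q₁ q₂ q₃ = Adjacent q₀ q₁ × Adjacent q₁ q₂ × Adjacent q₂ q₃ × ¬ Adjacent q₀ q₃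

inducedPath₄? : ∀ {d} (q₀ q₁ q₂ q₃ : Vertex d) → Dec (InducedPath₄ q₀ q₁ q₂ q₃)
inducedPath₄? q₀ q₁ q₂ q₃ =
  dist q₀ q₁ ≟ 1 ×-dec dist q₁ q₂ ≟ 1 ×-dec dist q₂ q₃ ≟ 1 ×-dec ¬? (dist q₀ q₃ ≟ 1)

inducedPath₄-hasGoodTriple : ∀ (q₀ q₁ q₂ q₃ : Vertex 3) → InducedPath₄ q₀ q₁ q₂ q₃ →
  ∀ w → HasGoodTriple (agrees (vertexSet (q₀ ∷ q₁ ∷ q₂ ∷ q₃ ∷ [])) w)
inducedPath₄-hasGoodTriple = toWitness
  {a? = ∀-vertex? λ q₀ → ∀-vertex? λ q₁ → ∀-vertex? λ q₂ → ∀-vertex? λ q₃ →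
          inducedPath₄? q₀ q₁ q₂ q₃ →-dec ∀-vertex? λ w →
            hasGoodTriple? (agrees (vertexSet (q₀ ∷ q₁ ∷ q₂ ∷ q₃ ∷ [])) w)}
  _

exactCopy≗vertexSet : ∀ {d k} {H K : Config d} (ps : Vec (Vertex d) k) →
  (∀ x → (H x ≡ true → ∃[ i ] lookup ps i ≡ x) × (∃[ i ] lookup ps i ≡ x → H x ≡ true)) →
  (copy : ExactCopy H K) → K ≗ vertexSet (mapᵥ (proj₁ copy) ps)
exactCopy≗vertexSet {K = K} ps onPath (σ , _ , image) y =
  does-⇔ (mk⇔ (toImage ∘ Equivalence.to T-≡) (Equivalence.from T-≡ ∘ fromImage))
         (T? (K y)) (y ∈? mapᵥ σ ps)
  where
    open VecDecMembership (≡-dec _≟ᵇ_) using (_∈?_)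

    toImage : K y ≡ true → y ∈ᵥ mapᵥ σ ps
    toImage Ky =
      let x , Hx , σx≡y = proj₁ (image y) Ky
          i , pᵢ≡x = proj₁ (onPath x) Hx
      in subst (_∈ᵥ mapᵥ σ ps) (trans (cong σ pᵢ≡x) σx≡y) (∈ᵥ-map⁺ σ (∈-lookup i ps))

    fromImage : y ∈ᵥ mapᵥ σ ps → K y ≡ true
    fromImage y∈ = proj₂ (image y) (lookup ps i , proj₂ (onPath _) (i , refl) ,
                     sym (trans (lookup-index y∈) (lookup-map i σ ps)))
      where i = VecAny.index y∈

perfectPath-copy-hasGoodTriple : ∀ {H K : Config 3} → IsPerfectPath 3 H → ExactCopy H K →
  ∀ w → HasGoodTriple (agrees K w)
perfectPath-copy-hasGoodTriple
  (ps@(p₀ ∷ p₁ ∷ p₂ ∷ p₃ ∷ []) , adjacent , ends , onPath) copy@(σ , (_ , adj⇔) , _) w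
  = let t , good = inducedPath₄-hasGoodTriple (σ p₀) (σ p₁) (σ p₂) (σ p₃) σ[path] w
    in t , subst T (sym (goodTriple-cong (agrees-cong (exactCopy≗vertexSet ps onPath copy) w) t)) good
  where
    σ-adjacent : ∀ i → Adjacent (σ (lookup ps (inject₁ i))) (σ (lookup ps (fsuc i)))
    σ-adjacent i = proj₁ (adj⇔ _ _) (adjacent i)

    σ[path] : InducedPath₄ (σ p₀) (σ p₁) (σ p₂) (σ p₃)
    σ[path] = σ-adjacent fzero , σ-adjacent (fsuc fzero) , σ-adjacent (fsuc (fsuc fzero)) ,
              λ a → case trans (sym ends) (proj₂ (adj⇔ p₀ p₃) a) of λ ()

-- Good triples determine their sub-cube

Distinct₃ : ∀ {A : Set} → A × A × A → Set
Distinct₃ (x , y , z) = x ≢ y × x ≢ z × y ≢ z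

infix 4 _∈₃_

_∈₃_ : ∀ {A : Set} → A → A × A × A → Set
a ∈₃ (x , y , z) = a ≡ x ⊎ a ≡ y ⊎ a ≡ z

∈₃-map₃ : ∀ {A B : Set} (f : A → B) {a} t → a ∈₃ t → f a ∈₃ map₃ f t
∈₃-map₃ f _ (inj₁ refl)        = inj₁ refl
∈₃-map₃ f _ (inj₂ (inj₁ refl)) = inj₂ (inj₁ refl)
∈₃-map₃ f _ (inj₂ (inj₂ refl)) = inj₂ (inj₂ refl)

Fin3-Distinct₃⇒∈₃ : ∀ (x y z : Fin 3) → Distinct₃ (x , y , z) → ∀ j → j ∈₃ (x , y , z)
Fin3-Distinct₃⇒∈₃ = toWitness
  {a? = Finₚ.all? λ x → Finₚ.all? λ y → Finₚ.all? λ z →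
          (¬? (x Finₚ.≟ y) ×-dec ¬? (x Finₚ.≟ z) ×-dec ¬? (y Finₚ.≟ z)) →-dec
          Finₚ.all? λ j → j Finₚ.≟ x ⊎-dec j Finₚ.≟ y ⊎-dec j Finₚ.≟ z}
  _

goodTriple-distinct : ∀ {d} (g : Vertex d → Bool) t → T (goodTriple g t) → Distinct₃ t
goodTriple-distinct g (x , y , z) good = x≢y , x≢z , y≢z
  where
    xy : T (differ g x y) × T (cornerAgrees g x y)
    xy = Equivalence.to (T-∧ {differ g x y}) (proj₁ (Equivalence.to (T-∧ {agreeingPair g x y}) good))
    xz : T (differ g x z) × T (not (cornerAgrees g x z))
    xz = Equivalence.to (T-∧ {differ g x z}) (proj₂ (Equivalence.to (T-∧ {agreeingPair g x y}) good))
    x≢y : x ≢ y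
    x≢y refl = subst T (xor-same (side g x)) (proj₁ xy)
    x≢z : x ≢ z
    x≢z refl = subst T (xor-same (side g x)) (proj₁ xz)
    y≢z : y ≢ z
    y≢z refl with cornerAgrees g x y | proj₂ xy | proj₂ xz
    ... | true  | _  | ()
    ... | false | () | _

-- The fallback is distinct too, so that witnessTriple below is injective on all choices.
chooseTriple : (Vertex 3 → Bool) → Fin 3 × Fin 3 × Fin 3
chooseTriple g with hasGoodTriple? g
... | yes (t , _) = t
... | no _        = fzero , fsuc fzero , fsuc (fsuc fzero)

chooseTriple-good : ∀ g → HasGoodTriple g → T (goodTriple g (chooseTriple g))
chooseTriple-good g found with hasGoodTriple? g
... | yes (_ , good) = good
... | no none        = ⊥-elim (none found)

chooseTriple-distinct : ∀ g → Distinct₃ (chooseTriple g)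
chooseTriple-distinct g with hasGoodTriple? g
... | yes (t , good) = goodTriple-distinct g t good
... | no _           = (λ ()) , (λ ()) , (λ ())

isFree⇔∈₃ : ∀ {n} (c : Choice n 3) t → Distinct₃ t → ∀ i → isFree c i ≡ true ⇔ i ∈₃ map₃ (pos c) t
isFree⇔∈₃ c t@(x , y , z) distinct i = mk⇔ toImage fromImage
  where
    toImage : isFree c i ≡ true → i ∈₃ map₃ (pos c) t
    toImage i-free with j , refl ← isFree⇒pos c i i-free =
      ∈₃-map₃ (pos c) t (Fin3-Distinct₃⇒∈₃ x y z distinct j)

    fromImage : i ∈₃ map₃ (pos c) t → isFree c i ≡ true
    fromImage (inj₁ refl)        = isFree-pos c x
    fromImage (inj₂ (inj₁ refl)) = isFree-pos c y
    fromImage (inj₂ (inj₂ refl)) = isFree-pos c z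

pos-injective : ∀ {n} (c c′ : Choice n 3) t t′ → Distinct₃ t → Distinct₃ t′ →
  map₃ (pos c) t ≡ map₃ (pos c′) t′ → c ≡ c′
pos-injective c c′ t t′ distinct distinct′ eq = isFree-injective c c′ λ i →
  ⇔→≡ (⇔-trans (isFree⇔∈₃ c t distinct i)
        (⇔-trans (mk⇔ (subst (i ∈₃_) eq) (subst (i ∈₃_) (sym eq)))
                 (⇔-sym (isFree⇔∈₃ c′ t′ distinct′ i))))

module _ {n} (g : Vertex n → Bool) where

  private
    F = allFin n

  goodTriplesAt : Fin n → List (Fin n × Fin n × Fin n)
  goodTriplesAt x =
    map (x ,_) (cartesianProduct (filterᵇ (agreeingPair g x) F) (filterᵇ (disagreeingPair g x) F))

  goodTriples : List (Fin n × Fin n × Fin n)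
  goodTriples = concatMap goodTriplesAt F

  ∈-goodTriples : ∀ t → T (goodTriple g t) → t ∈ goodTriples
  ∈-goodTriples (x , y , z) good = ∈-concatMap⁺ goodTriplesAt (lose (∈-allFin x) (∈-map⁺ (x ,_)
    (∈-cartesianProduct⁺ (∈-filter⁺ (T? ∘ agreeingPair g x) (∈-allFin y) xy)
                         (∈-filter⁺ (T? ∘ disagreeingPair g x) (∈-allFin z) xz))))
    where
      xy = proj₁ (Equivalence.to (T-∧ {agreeingPair g x y}) good)
      xz = proj₂ (Equivalence.to (T-∧ {agreeingPair g x y}) good)

  length-goodTriplesAt : ∀ x →
    length (goodTriplesAt x) ≡ count (agreeingPair g x) F * count (disagreeingPair g x) F
  length-goodTriplesAt x =
    trans (length-map (x ,_) (cartesianProduct As Bs)) (length-cartesianProduct As Bs)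
    where
      As = filterᵇ (agreeingPair g x) F
      Bs = filterᵇ (disagreeingPair g x) F

  goodTriples-bound : 16 * length goodTriples ≤ n * (n * n)
  goodTriples-bound = begin
    16 * length goodTriples                  ≡⟨ cong (16 *_) length-goodTriples ⟩
    16 * sum (map AB F)                      ≡⟨ *-assoc 4 4 (sum (map AB F)) ⟩
    4 * (4 * sum (map AB F))                 ≡⟨ cong (4 *_) (*-distribˡ-sum-map 4 AB F) ⟩
    4 * sum (map (λ x → 4 * AB x) F)         ≤⟨ *-monoʳ-≤ 4 (sum-map-mono-≤ am-gm-at F) ⟩
    4 * sum (map (O² ∘ side g) F)            ≡⟨ cong (4 *_) (sum-map-∘-Bool O² (side g) F) ⟩
    4 * (m * (m′ * m′) + m′ * (m * m))       ≤⟨ cube-bound m m′ ⟩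
    (m + m′) * ((m + m′) * (m + m′))         ≡⟨ cong (λ s → s * (s * s)) m+m′≡n ⟩
    n * (n * n)                              ∎
    where
      open ≤-Reasoning
      AB : Fin n → ℕ
      AB x = count (agreeingPair g x) F * count (disagreeingPair g x) F
      O² : Bool → ℕ
      O² s = count (λ y → s xor side g y) F * count (λ y → s xor side g y) F
      m m′ : ℕ
      m  = count (side g) F
      m′ = count (not ∘ side g) F

      length-goodTriples : length goodTriples ≡ sum (map AB F)
      length-goodTriples =
        trans (length-concatMap goodTriplesAt F) (cong sum (map-cong length-goodTriplesAt F))

      am-gm-at : ∀ x → 4 * AB x ≤ O² (side g x)
      am-gm-at x = subst (λ s → 4 * AB x ≤ s * s) (count-∧-split (differ g x) (cornerAgrees g x) F)
                         (am-gm (count (agreeingPair g x) F) (count (disagreeingPair g x) F))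

      m+m′≡n : m + m′ ≡ n
      m+m′≡n = trans (count-complement (side g) F) (length-tabulate (λ i → i))

module _ {n} (S : Config n) (v : Vertex n) where

  localTriple : Choice n 3 → Fin 3 × Fin 3 × Fin 3
  localTriple c = chooseTriple (agrees (trace S v c) (restrict c v))

  witnessTriple : Choice n 3 → Fin n × Fin n × Fin n
  witnessTriple c = map₃ (pos c) (localTriple c)

  witnessTriple-injective : ∀ {c c′} → witnessTriple c ≡ witnessTriple c′ → c ≡ c′
  witnessTriple-injective {c} {c′} = pos-injective c c′ (localTriple c) (localTriple c′)
    (chooseTriple-distinct (agrees (trace S v c) (restrict c v)))
    (chooseTriple-distinct (agrees (trace S v c′) (restrict c′ v)))

  witnessTriple-good : ∀ {H} → IsPerfectPath 3 H → ∀ c → ExactCopy H (trace S v c) →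
    T (goodTriple (agrees S v) (witnessTriple c))
  witnessTriple-good path c copy = subst T (goodTriple-trace S v c (localTriple c))
    (chooseTriple-good (agrees (trace S v c) (restrict c v))
                       (perfectPath-copy-hasGoodTriple path copy (restrict c v)))

  perfectPath-copies-bound : ∀ {H} → IsPerfectPath 3 H → (cs : List (Choice n 3)) → Unique cs →
    All (λ c → ExactCopy H (trace S v c)) cs → 16 * length cs ≤ n * (n * n)
  perfectPath-copies-bound path cs unique copies = begin
    16 * length cs
      ≡⟨ cong (16 *_) (length-map witnessTriple cs) ⟨
    16 * length (map witnessTriple cs)
      ≤⟨ *-monoʳ-≤ 16 (Unique∧⊆⇒length≤ witnesses-unique witnesses-good) ⟩
    16 * length (goodTriples (agrees S v))
      ≤⟨ goodTriples-bound (agrees S v) ⟩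
    n * (n * n)
      ∎
    where
      open ≤-Reasoning
      witnesses-unique : Unique (map witnessTriple cs)
      witnesses-unique = Unique.map⁺ {f = witnessTriple} witnessTriple-injective unique

      witnesses-good : map witnessTriple cs ⊆ goodTriples (agrees S v)
      witnesses-good t∈ =
        let c , c∈cs , t≡ = ∈-map⁻ witnessTriple t∈
        in subst (_∈ goodTriples (agrees S v)) (sym t≡)
             (∈-goodTriples (agrees S v) (witnessTriple c)
                            (witnessTriple-good path c (All.lookup copies c∈cs)))

proposition10 : (H : Config 3) → IsPerfectPath 3 H →
    ∀ (k : ℕ) → ∃[ n₀ ] (∀ (n : ℕ) → n₀ ≤ n → ∀ (S : Config n) (v : Vertex n) →
      GBoundedBy H n S v (8 * suc k) ((3 * suc k + 8) * (n C 3)))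
proposition10 H path k = 2 + 2 * suc k , λ n n₀≤n S v cs unique copies →
  cube⇒binomial-bound (suc k) (length cs) n n₀≤n (perfectPath-copies-bound S v path cs unique copies)
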